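{- Let $n$, $a$, $q$, $r$ be integers with $n=qa+r$, $a\ge 4$, $q\ge 2$ and $0\le r\le a-1$. Then $\mathrm{diam}(\overrightarrow{C}(n;1,a)) \le q+a-2$.
   Context: The oriented circulant graph $\overrightarrow{C}(n;1,a)$ has vertex set $\{v_0,\dots,v_{n-1}\}$ and arcs $v_iv_{i+1}$ and $v_iv_{i+a}$ for all $i$, subscripts modulo $n$. $d(u,v)$ is the length of a shortest directed path from $u$ to $v$; $e(v)=\max_u d(v,u)$; $\mathrm{diam}$ is the maximum eccentricity. -}

module Defs where

open import Data.Nat using (ℕ; zero; suc; _+_; _≤_; NonZero)
open import Data.Nat.DivMod using (_%_)
open import Data.Fin using (Fin; toℕ)
open import Data.Sum using (_⊎_)
open import Data.Product using (∃; _×_)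
open import Relation.Binary.PropositionalEquality using (_≡_)

-- Arcs of the oriented circulant graph C(n;1,a) on vertices v_0..v_{n-1}
-- (vertex v_i represented by i : Fin n): v_i -> v_{i+1} and v_i -> v_{i+a}, mod n.
Arc : (n a : ℕ) → .{{_ : NonZero n}} → Fin n → Fin n → Set
Arc n a i j = (toℕ j ≡ (toℕ i + 1) % n) ⊎ (toℕ j ≡ (toℕ i + a) % n)

data Walk (n a : ℕ) .{{_ : NonZero n}} : Fin n → Fin n → ℕ → Set where
  here : ∀ {u} → Walk n a u u zero
  step : ∀ {u w v k} → Arc n a u w → Walk n a w v k → Walk n a u v (suc k)

-- d(u,v) ≤ D : there is a directed path (equivalently walk) from u to v of length ≤ D.
Dist≤ : (n a : ℕ) → .{{_ : NonZero n}} → Fin n → Fin n → ℕ → Set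
Dist≤ n a u v D = ∃ λ k → k ≤ D × Walk n a u v k

Diam≤ : (n a : ℕ) → .{{_ : NonZero n}} → ℕ → Set
Diam≤ n a D = ∀ (u v : Fin n) → Dist≤ n a u v D

-- Every v is reached from u as u + d (mod n) with 0 ≤ d < n. Writing d = x a + y
-- with y < a, the walk of x jumps of length a followed by y unit steps has length
-- x + y. Either x < q, and then x + y ≤ (q − 1) + (a − 1); or x = q (as d < (q + 1) a),
-- and then y < r ≤ a − 1, so again x + y ≤ q + a − 2.
module Submission where

open import Defs
open import Data.Nat using (ℕ; zero; suc; _+_; _*_; _∸_; _≤_; _<_; NonZero; >-nonZero; s≤s; z≤n; _/_; _%_)
open import Data.Nat.Properties
open import Data.Nat.DivMod
open import Data.Fin using (Fin; toℕ)
open import Data.Fin.Properties using (toℕ-fromℕ<; toℕ-injective; toℕ<n)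
open import Data.Sum using (inj₁; inj₂)
open import Data.Product using (_,_)
open import Relation.Binary.PropositionalEquality

[m%n+k]%n≡[m+k]%n : ∀ m k n .{{_ : NonZero n}} → (m % n + k) % n ≡ (m + k) % n
[m%n+k]%n≡[m+k]%n m k n = begin
  (m % n + k) % n          ≡⟨ %-distribˡ-+ (m % n) k n ⟩
  (m % n % n + k % n) % n  ≡⟨ cong (λ t → (t + k % n) % n) (m%n%n≡m%n m n) ⟩
  (m % n + k % n) % n      ≡⟨ %-distribˡ-+ m k n ⟨
  (m + k) % n              ∎
  where open ≡-Reasoning

m<q*n+r⇒m/n≤q : ∀ {m} q {r n} .{{_ : NonZero n}} → m < q * n + r → r < n → m / n ≤ q
m<q*n+r⇒m/n≤q {m} q {r} {n} m<qn+r r<n = <⇒≤pred (m<n*o⇒m/o<n (begin-strict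
  m          <⟨ m<qn+r ⟩
  q * n + r  <⟨ +-monoʳ-< (q * n) r<n ⟩
  q * n + n  ≡⟨ +-comm (q * n) n ⟩
  suc q * n  ∎))
  where open ≤-Reasoning

m<q*n+r∧m/n≡q⇒m%n<r : ∀ {m q r n} .{{_ : NonZero n}} → m < q * n + r → m / n ≡ q → m % n < r
m<q*n+r∧m/n≡q⇒m%n<r {m} {q} {r} {n} m<qn+r refl = +-cancelʳ-< (m / n * n) (m % n) r (begin-strict
  m % n + m / n * n  ≡⟨ m≡m%n+[m/n]*n m n ⟨
  m                  <⟨ m<qn+r ⟩
  m / n * n + r      ≡⟨ +-comm (m / n * n) r ⟩
  r + m / n * n      ∎)
  where open ≤-Reasoning

m<q*n+r⇒m/n+m%n≤q+n∸2 : ∀ {m} q {r n} .{{_ : NonZero n}} → m < q * n + r → r < n →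
                        m / n + m % n ≤ q + n ∸ 2
m<q*n+r⇒m/n+m%n≤q+n∸2 {m} q {r} {n} m<qn+r r<n =
  ∸-monoˡ-≤ 2 (subst (_≤ q + n) (+-suc (suc (m / n)) (m % n)) two+sum≤q+n)
  where
  two+sum≤q+n : suc (m / n) + suc (m % n) ≤ q + n
  two+sum≤q+n with m≤n⇒m<n∨m≡n (m<q*n+r⇒m/n≤q q m<qn+r r<n)
  ... | inj₁ m/n<q = +-mono-≤ m/n<q (m%n<n m n)
  ... | inj₂ m/n≡q = begin
    suc (m / n) + suc (m % n)  ≡⟨ +-suc (m / n) (suc (m % n)) ⟨
    m / n + suc (suc (m % n))  ≤⟨ +-mono-≤ (≤-reflexive m/n≡q) (≤-trans (s≤s (m<q*n+r∧m/n≡q⇒m%n<r m<qn+r m/n≡q)) r<n) ⟩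
    q + n                      ∎
    where open ≤-Reasoning

module _ {n : ℕ} .{{_ : NonZero n}} where

  infixl 6 _⊕_

  _⊕_ : Fin n → ℕ → Fin n
  u ⊕ k = (toℕ u + k) mod n

  toℕ-⊕ : ∀ u k → toℕ (u ⊕ k) ≡ (toℕ u + k) % n
  toℕ-⊕ u k = toℕ-fromℕ< (m%n<n (toℕ u + k) n)

  ⊕-identityʳ : ∀ u → u ⊕ 0 ≡ u
  ⊕-identityʳ u = toℕ-injective (begin
    toℕ (u ⊕ 0)       ≡⟨ toℕ-⊕ u 0 ⟩
    (toℕ u + 0) % n   ≡⟨ cong (_% n) (+-identityʳ (toℕ u)) ⟩
    toℕ u % n         ≡⟨ m<n⇒m%n≡m (toℕ<n u) ⟩
    toℕ u             ∎)
    where open ≡-Reasoning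

  ⊕-assoc : ∀ u j k → u ⊕ j ⊕ k ≡ u ⊕ (j + k)
  ⊕-assoc u j k = toℕ-injective (begin
    toℕ (u ⊕ j ⊕ k)            ≡⟨ toℕ-⊕ (u ⊕ j) k ⟩
    (toℕ (u ⊕ j) + k) % n      ≡⟨ cong (λ t → (t + k) % n) (toℕ-⊕ u j) ⟩
    ((toℕ u + j) % n + k) % n  ≡⟨ [m%n+k]%n≡[m+k]%n (toℕ u + j) k n ⟩
    (toℕ u + j + k) % n        ≡⟨ cong (_% n) (+-assoc (toℕ u) j k) ⟩
    (toℕ u + (j + k)) % n      ≡⟨ toℕ-⊕ u (j + k) ⟨
    toℕ (u ⊕ (j + k))          ∎)
    where open ≡-Reasoning

  _⊖_ : Fin n → Fin n → ℕ
  v ⊖ u = (toℕ v + (n ∸ toℕ u)) % n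

  ⊖<n : ∀ v u → v ⊖ u < n
  ⊖<n v u = m%n<n (toℕ v + (n ∸ toℕ u)) n

  ⊕-⊖ : ∀ u v → u ⊕ (v ⊖ u) ≡ v
  ⊕-⊖ u v = toℕ-injective (begin
    toℕ (u ⊕ (v ⊖ u))                  ≡⟨ toℕ-⊕ u (v ⊖ u) ⟩
    (toℕ u + v ⊖ u) % n                ≡⟨ cong (_% n) (+-comm (toℕ u) (v ⊖ u)) ⟩
    (v ⊖ u + toℕ u) % n                ≡⟨ [m%n+k]%n≡[m+k]%n (toℕ v + (n ∸ toℕ u)) (toℕ u) n ⟩
    (toℕ v + (n ∸ toℕ u) + toℕ u) % n  ≡⟨ cong (_% n) (+-assoc (toℕ v) (n ∸ toℕ u) (toℕ u)) ⟩
    (toℕ v + (n ∸ toℕ u + toℕ u)) % n  ≡⟨ cong (λ t → (toℕ v + t) % n) (m∸n+n≡m (<⇒≤ (toℕ<n u))) ⟩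
    (toℕ v + n) % n                    ≡⟨ [m+n]%n≡m%n (toℕ v) n ⟩
    toℕ v % n                          ≡⟨ m<n⇒m%n≡m (toℕ<n v) ⟩
    toℕ v                              ∎)
    where open ≡-Reasoning

  walk-⊕ : ∀ a u x y → Walk n a u (u ⊕ (x * a + y)) (x + y)
  walk-⊕ a u zero zero = subst (λ w → Walk n a u w 0) (sym (⊕-identityʳ u)) here
  walk-⊕ a u zero (suc y) =
    step (inj₁ (toℕ-⊕ u 1))
         (subst (λ w → Walk n a (u ⊕ 1) w y) (⊕-assoc u 1 y) (walk-⊕ a (u ⊕ 1) zero y))
  walk-⊕ a u (suc x) y =
    step (inj₂ (toℕ-⊕ u a))
         (subst (λ w → Walk n a (u ⊕ a) w (x + y)) ⊕-reassoc (walk-⊕ a (u ⊕ a) x y))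
    where
    ⊕-reassoc : u ⊕ a ⊕ (x * a + y) ≡ u ⊕ (a + x * a + y)
    ⊕-reassoc = trans (⊕-assoc u a (x * a + y)) (cong (u ⊕_) (sym (+-assoc a (x * a) y)))

  walk-⊕-/-% : ∀ a .{{_ : NonZero a}} u d → Walk n a u (u ⊕ d) (d / a + d % a)
  walk-⊕-/-% a u d =
    subst (λ w → Walk n a u w (d / a + d % a)) (cong (u ⊕_) [d/a]*a+d%a≡d) (walk-⊕ a u (d / a) (d % a))
    where
    [d/a]*a+d%a≡d : d / a * a + d % a ≡ d
    [d/a]*a+d%a≡d = trans (+-comm (d / a * a) (d % a)) (sym (m≡m%n+[m/n]*n d a))

proposition8 : (n a q r : ℕ) → .{{_ : NonZero n}} →
    n ≡ q * a + r → 4 ≤ a → 2 ≤ q → r < a →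
    Diam≤ n a (q + a ∸ 2)
proposition8 n a q r refl 4≤a _ r<a u v =
  d / a + d % a ,
  m<q*n+r⇒m/n+m%n≤q+n∸2 q (⊖<n v u) r<a ,
  subst (λ w → Walk n a u w (d / a + d % a)) (⊕-⊖ u v) (walk-⊕-/-% a u d)
  where
  instance
    a≢0 : NonZero a
    a≢0 = >-nonZero (≤-trans (s≤s z≤n) 4≤a)
  d : ℕ
  d = v ⊖ u
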